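{- Let $P$ be a definite logic program, $\leftarrow Q$ a query ($Q$ a conjunction of atoms), $J$ a pre-interpretation of $P$ with domain $D$, and $I$ an interpretation of $P$ based on $J$. Let $I^a = I \cup I_J$ be the corresponding interpretation of $P^a \cup P^a_J$. Then $I$ is a model of $P \cup \{\mathit{false}\leftarrow Q\}$ if and only if $I^a$ is a model of $P^a \cup P^a_J \cup \{\mathit{false}\leftarrow Q^a\}$.
   Context: A pre-interpretation $J$ of $P$ consists of a domain $D$ and for each functor $f/n$ of $P$ a map $f_J:D^n\to D$; an interpretation $I$ based on $J$ additionally assigns to each predicate $p/n$ a map $D^n\to\{\mathit{true},\mathit{false}\}$, and is identified with the set of atoms $p(d_1,\dots,d_n)$, $d_i\in D$, that are true. Abstract compilation: in a clause (or query), repeatedly replace a non-variable term $f(t_1,\dots,t_n)$ occurring in it by a fresh variable $X$ and add the atom $p_f(t_1,\dots,t_n,X)$ to the body, where $p_f/(n+1)$ is a new predicate symbol associated with $f/n$ (for a constant $a$ this adds $p_a(X)$), until no non-variable terms remain. $Cl^a$ denotes the result for a clause $Cl$, $P^a$ the set of abstracted clauses of $P$, and $Q^a$ the abstracted query body. $P^a_J$ is the set of facts $\{p_f(d_1,\dots,d_n,d)\leftarrow \;:\; f_J(d_1,\dots,d_n)=d\}$ (the relational form of $J$). The program $P^a\cup P^a_J$ has as its only function symbols the elements of $D$ (as constants), so its Herbrand pre-interpretation has domain $D$. $I_J$ is the least Herbrand model of $P^a_J$ (the set of those facts), and $I^a = I\cup I_J$ is the Herbrand interpretation of $P^a\cup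 P^a_J$ in which the program predicates are interpreted as in $I$ and each $p_f$ as the graph of $f_J$. -}

module Defs where

open import Data.Nat using (ℕ; zero; suc)
open import Data.Vec using (Vec; []; _∷_; _∷ʳ_; init; last)
open import Data.List using (List; []; _∷_; _++_; map)
open import Data.List.Relation.Unary.All using (All)
open import Data.List.Membership.Propositional using (_∈_)
open import Data.Maybe using (Maybe; just; nothing)
open import Data.Product using (Σ; _×_; _,_)
open import Data.Sum using (_⊎_; inj₁; inj₂)
open import Data.Empty using (⊥)
open import Relation.Binary.PropositionalEquality using (_≡_)

record Lang : Set₁ where
  field
    Fun    : Set
    farity : Fun → ℕ
    Pred   : Set
    parity : Pred → ℕ
open Lang public

data Term (L : Lang) (V : Set) : Set where
  var : V → Term L V
  app : (f : Fun L) → Vec (Term L V) (farity L f) → Term L V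

record Atom (L : Lang) (V : Set) : Set where
  constructor atom
  field
    pred : Pred L
    args : Vec (Term L V) (parity L pred)

record DefClause (L : Lang) (V : Set) : Set where
  constructor _⇐_
  field
    head : Atom L V
    body : List (Atom L V)

-- General clauses: head 'nothing' stands for 'false'
record Clause (L : Lang) (V : Set) : Set where
  constructor _⇐'_
  field
    head : Maybe (Atom L V)
    body : List (Atom L V)

toClause : ∀ {L V} → DefClause L V → Clause L V
toClause (h ⇐ b) = just h ⇐' b

denial : ∀ {L V} → List (Atom L V) → Clause L V
denial Q = nothing ⇐' Q

-- sets of clauses (possibly infinite) as predicates
ClauseSet : Lang → Set → Set₁
ClauseSet L V = Clause L V → Set

fromList : ∀ {L V} → List (DefClause L V) → ClauseSet L V
fromList P c = c ∈ map toClause P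

_∪_ : ∀ {L V} → ClauseSet L V → ClauseSet L V → ClauseSet L V
(S ∪ T) c = S c ⊎ T c

singleton : ∀ {L V} → Clause L V → ClauseSet L V
singleton c c' = c' ≡ c

record PreInterp (L : Lang) : Set₁ where
  field
    Dom : Set
    fun : (f : Fun L) → Vec Dom (farity L f) → Dom
open PreInterp public

Interp : (L : Lang) → PreInterp L → Set₁
Interp L J = (p : Pred L) → Vec (Dom J) (parity L p) → Set

module _ {L : Lang} (J : PreInterp L) {V : Set} (σ : V → Dom J) where
  mutual
    evalT : Term L V → Dom J
    evalT (var x)    = σ x
    evalT (app f ts) = fun J f (evalTs ts)

    evalTs : ∀ {n} → Vec (Term L V) n → Vec (Dom J) n
    evalTs []       = []
    evalTs (t ∷ ts) = evalT t ∷ evalTs ts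

  AtomTrue : Interp L J → Atom L V → Set
  AtomTrue I (atom p ts) = I p (evalTs ts)

  HeadTrue : Interp L J → Maybe (Atom L V) → Set
  HeadTrue I (just a) = AtomTrue I a
  HeadTrue I nothing  = ⊥

  ClauseTrue : Interp L J → Clause L V → Set
  ClauseTrue I (h ⇐' b) = All (AtomTrue I) b → HeadTrue I h

Models : ∀ {L V} (J : PreInterp L) → Interp L J → ClauseSet L V → Set
Models {L} {V} J I S =
  ∀ (c : Clause L V) → S c → (σ : V → Dom J) → ClauseTrue J σ I c

-- Language of P^a ∪ P^a_J : the elements of D are the only function
-- symbols (constants); predicates are those of P plus p_f/(n+1) for f/n.
AbsLang : (L : Lang) → PreInterp L → Lang
AbsLang L J = record
  { Fun    = Dom J
  ; farity = λ _ → 0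
  ; Pred   = Pred L ⊎ Fun L
  ; parity = λ { (inj₁ p) → parity L p ; (inj₂ f) → suc (farity L f) } }

-- Variables of abstracted clauses: inj₁ x = original variable x,
-- inj₂ k = k-th fresh variable introduced by abstraction.
AVar : Set
AVar = ℕ ⊎ ℕ

module Abstraction (L : Lang) (J : PreInterp L) where
  La = AbsLang L J
  ATerm = Term La AVar
  AAtom = Atom La AVar

  pf : (f : Fun L) → Vec ATerm (suc (farity L f)) → AAtom
  pf f ts = atom (inj₂ f) ts

  -- abstract a term, given the next fresh-variable index; returns the
  -- replacing term (a variable), the added atoms, and the next index.
  mutual
    absT : Term L ℕ → ℕ → ATerm × List AAtom × ℕ
    absT (var x) k = var (inj₁ x) , [] , k
    absT (app f ts) k with absTs ts k
    ... | vs , as , k' = var (inj₂ k') , as ++ (pf f (vs ∷ʳ var (inj₂ k')) ∷ []) , suc k'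

    absTs : ∀ {n} → Vec (Term L ℕ) n → ℕ → Vec ATerm n × List AAtom × ℕ
    absTs [] k = [] , [] , k
    absTs (t ∷ ts) k with absT t k
    ... | v , as , k' with absTs ts k'
    ...   | vs , bs , k'' = v ∷ vs , as ++ bs , k''

  absA : Atom L ℕ → ℕ → AAtom × List AAtom × ℕ
  absA (atom p ts) k with absTs ts k
  ... | vs , as , k' = atom (inj₁ p) vs , as , k'

  absAs : List (Atom L ℕ) → ℕ → List AAtom × List AAtom × ℕ
  absAs [] k = [] , [] , k
  absAs (a ∷ as) k with absA a k
  ... | a' , gs , k' with absAs as k'
  ...   | as' , hs , k'' = a' ∷ as' , gs ++ hs , k''

  absClause : DefClause L ℕ → DefClause La AVar
  absClause (h ⇐ b) with absA h 0
  ... | h' , gs , k with absAs b k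
  ...   | b' , hs , _ = h' ⇐ (b' ++ (gs ++ hs))

  absProgram : List (DefClause L ℕ) → List (DefClause La AVar)
  absProgram = map absClause

  absQuery : List (Atom L ℕ) → List AAtom
  absQuery Q with absAs Q 0
  ... | Q' , gs , _ = Q' ++ gs

  cst : Dom J → ATerm
  cst d = app d []

  PaJ : ClauseSet La AVar
  PaJ c = Σ (Fun L) λ f → Σ (Vec (Dom J) (farity L f)) λ ds →
            c ≡ toClause (pf f (Data.Vec.map cst (ds ∷ʳ fun J f ds)) ⇐ [])

  HJ : PreInterp La
  HJ = record { Dom = Dom J ; fun = λ d _ → d }

  Ia : Interp L J → Interp La HJ
  Ia I (inj₁ p) ds = I p ds
  Ia I (inj₂ f) ds = fun J f (init ds) ≡ last ds

-- Under an assignment that makes every added atom p_f(x₁,…,xₙ,x) true, each fresh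
-- variable x holds the value under J of the subterm it replaced, so an abstracted atom
-- is true in Iᵃ exactly when the original atom is true in I. Conversely, for any
-- assignment of the original variables the fresh variables can always be given these
-- values: they are numbered in the order the subterms are processed, and the value of
-- each fresh variable only constrains variables numbered below it.
module Submission where

open import Defs
open import Data.Nat using (ℕ; suc; _≤_; _<_)
open import Data.Nat.Properties
  using (≤-refl; ≤-trans; <-≤-trans; m≤n⇒m≤1+n; m<n⇒m<1+n; n<1+n; n≮n; _<?_)
open import Data.List using (List; []; _∷_; _++_)
open import Data.List.Relation.Unary.All using (All; []; _∷_; head)
open import Data.List.Relation.Unary.All.Properties using (++⁺; ++⁻; ++⁻ˡ; ++⁻ʳ)
open import Data.List.Membership.Propositional.Properties using (∈-map⁺; ∈-map⁻)
open import Data.Vec using (Vec; []; _∷_; _∷ʳ_)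
import Data.Vec as Vec
open import Data.Vec.Properties using (init-∷ʳ; last-∷ʳ)
open import Data.Product using (Σ; _×_; _,_; proj₁; proj₂)
open import Data.Sum using (inj₁; inj₂; [_,_])
open import Data.Unit using (⊤; tt)
open import Data.Empty using (⊥-elim)
open import Function using (_∘_; id)
open import Function.Bundles using (_⇔_; mk⇔; Equivalence)
open import Relation.Nullary using (yes; no)
open import Relation.Binary.PropositionalEquality
  using (_≡_; refl; sym; trans; cong; cong₂; subst; module ≡-Reasoning)

open Equivalence using (to; from)

evalTs-∷ʳ : ∀ {L} (J : PreInterp L) {V} (σ : V → Dom J) {n}
            (ts : Vec (Term L V) n) (t : Term L V) →
            evalTs J σ (ts ∷ʳ t) ≡ evalTs J σ ts ∷ʳ evalT J σ t
evalTs-∷ʳ J σ []       t = refl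
evalTs-∷ʳ J σ (u ∷ ts) t = cong (evalT J σ u ∷_) (evalTs-∷ʳ J σ ts t)

module _ {D : Set} where

  AgreeBelow : ℕ → (ℕ → D) → (ℕ → D) → Set
  AgreeBelow n ρ ρ′ = ∀ {i} → i < n → ρ i ≡ ρ′ i

  -- F only reads the values below n, and can be met by changing values from k on only.
  record Fillable (k n : ℕ) (F : (ℕ → D) → Set) : Set where
    field
      bounded : k ≤ n
      frame   : ∀ {ρ ρ′} → AgreeBelow n ρ ρ′ → F ρ → F ρ′
      fill    : ∀ ρ → Σ (ℕ → D) λ ρ′ → F ρ′ × AgreeBelow k ρ′ ρ
  open Fillable

  fillable-⊤ : ∀ {k} → Fillable k k (λ _ → ⊤)
  fillable-⊤ = record
    { bounded = ≤-refl
    ; frame   = λ _ _ → tt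
    ; fill    = λ ρ → ρ , tt , λ _ → refl
    }

  fillable-× : ∀ {k m n F G} → Fillable k m F → Fillable m n G →
               Fillable k n (λ ρ → F ρ × G ρ)
  fillable-× {F = F} {G} 𝔽 𝔾 = record
    { bounded = ≤-trans (bounded 𝔽) (bounded 𝔾)
    ; frame   = λ agree (x , y) →
        frame 𝔽 (λ i<m → agree (<-≤-trans i<m (bounded 𝔾))) x , frame 𝔾 agree y
    ; fill    = fill-both
    }
    where
    fill-both : ∀ ρ → Σ (ℕ → D) λ ρ′ → (F ρ′ × G ρ′) × AgreeBelow _ ρ′ ρ
    fill-both ρ =
      let (ρ₁ , x , agree₁) = fill 𝔽 ρ
          (ρ₂ , y , agree₂) = fill 𝔾 ρ₁
      in ρ₂ , (frame 𝔽 (λ i<m → sym (agree₂ i<m)) x , y)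
            , λ i<k → trans (agree₂ (<-≤-trans i<k (bounded 𝔽))) (agree₁ i<k)

  extend : (ℕ → D) → ℕ → D → ℕ → D
  extend ρ n v i with i <? n
  ... | yes _ = ρ i
  ... | no  _ = v

  extend-< : ∀ ρ {n} v {i} → i < n → extend ρ n v i ≡ ρ i
  extend-< ρ {n} v {i} i<n with i <? n
  ... | yes _   = refl
  ... | no  i≮n = ⊥-elim (i≮n i<n)

  extend-≡ : ∀ ρ n v → extend ρ n v n ≡ v
  extend-≡ ρ n v with n <? n
  ... | yes n<n = ⊥-elim (n≮n n n<n)
  ... | no  _   = refl

  fillable-point : ∀ {k n F} → Fillable k n F → (v : D) →
                   Fillable k (suc n) (λ ρ → F ρ × ρ n ≡ v)
  fillable-point {n = n} 𝔽 v = record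
    { bounded = m≤n⇒m≤1+n (bounded 𝔽)
    ; frame   = λ agree (x , ρn≡v) →
        frame 𝔽 (agree ∘ m<n⇒m<1+n) x , trans (sym (agree (n<1+n n))) ρn≡v
    ; fill    = λ ρ →
        let (ρ₁ , x , agree₁) = fill 𝔽 ρ
        in extend ρ₁ n v
           , (frame 𝔽 (sym ∘ extend-< ρ₁ v) x , extend-≡ ρ₁ n v)
           , λ i<k → trans (extend-< ρ₁ v (<-≤-trans i<k (bounded 𝔽))) (agree₁ i<k)
    }

result : ∀ {A B C : Set} → A × B × C → A
result = proj₁

generated : ∀ {A B C : Set} → A × B × C → B
generated = proj₁ ∘ proj₂

nextFresh : ∀ {A B C : Set} → A × B × C → C
nextFresh = proj₂ ∘ proj₂

module Correctness (L : Lang) (J : PreInterp L) (I : Interp L J) where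
  open Abstraction L J
  open Fillable

  D : Set
  D = Dom J

  Holds : (AVar → D) → AAtom → Set
  Holds τ = AtomTrue HJ τ (Ia I)

  pf-holds : ∀ τ f (vs : Vec ATerm (farity L f)) v →
             Holds τ (pf f (vs ∷ʳ v)) ⇔ (fun J f (evalTs HJ τ vs) ≡ evalT HJ τ v)
  pf-holds τ f vs v
    rewrite evalTs-∷ʳ HJ τ vs v
          | init-∷ʳ (evalT HJ τ v) (evalTs HJ τ vs)
          | last-∷ʳ (evalT HJ τ v) (evalTs HJ τ vs) = mk⇔ id id

  evalTs-cst : ∀ τ {n} (ds : Vec D n) → evalTs HJ τ (Vec.map cst ds) ≡ ds
  evalTs-cst τ []       = refl
  evalTs-cst τ (d ∷ ds) = cong (d ∷_) (evalTs-cst τ ds)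

  PaJ-holds : ∀ τ f (ds : Vec D (farity L f)) →
              Holds τ (pf f (Vec.map cst (ds ∷ʳ fun J f ds)))
  PaJ-holds τ f ds
    rewrite evalTs-cst τ (ds ∷ʳ fun J f ds)
          | init-∷ʳ (fun J f ds) ds
          | last-∷ʳ (fun J f ds) ds = refl

  mutual
    absT-sound : ∀ τ t k → All (Holds τ) (generated (absT t k)) →
                 evalT HJ τ (result (absT t k)) ≡ evalT J (τ ∘ inj₁) t
    absT-sound τ (var x)    k _    = refl
    absT-sound τ (app f ts) k hold = begin
      τ (inj₂ (nextFresh (absTs ts k)))
        ≡⟨ sym (to (pf-holds τ f _ _) (head (++⁻ʳ (generated (absTs ts k)) hold))) ⟩
      fun J f (evalTs HJ τ (result (absTs ts k)))
        ≡⟨ cong (fun J f) (absTs-sound τ ts k (++⁻ˡ (generated (absTs ts k)) hold)) ⟩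
      fun J f (evalTs J (τ ∘ inj₁) ts) ∎
      where open ≡-Reasoning

    absTs-sound : ∀ τ {n} (ts : Vec (Term L ℕ) n) k → All (Holds τ) (generated (absTs ts k)) →
                  evalTs HJ τ (result (absTs ts k)) ≡ evalTs J (τ ∘ inj₁) ts
    absTs-sound τ []       k _    = refl
    absTs-sound τ (t ∷ ts) k hold =
      let (hold-t , hold-ts) = ++⁻ (generated (absT t k)) hold
      in cong₂ _∷_ (absT-sound τ t k hold-t) (absTs-sound τ ts _ hold-ts)

  absA-correct : ∀ τ a k → All (Holds τ) (generated (absA a k)) →
                 Holds τ (result (absA a k)) ⇔ AtomTrue J (τ ∘ inj₁) I a
  absA-correct τ (atom p ts) k hold = mk⇔ (subst (I p) args≡) (subst (I p) (sym args≡))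
    where args≡ = absTs-sound τ ts k hold

  absAs-correct : ∀ τ as k → All (Holds τ) (generated (absAs as k)) →
                  All (Holds τ) (result (absAs as k)) ⇔ All (AtomTrue J (τ ∘ inj₁) I) as
  absAs-correct τ []       k _    = mk⇔ (λ _ → []) (λ _ → [])
  absAs-correct τ (a ∷ as) k hold =
    mk⇔ (λ { (x ∷ xs) → to a⇔ x ∷ to as⇔ xs }) (λ { (x ∷ xs) → from a⇔ x ∷ from as⇔ xs })
    where
    a⇔  = absA-correct τ a k (++⁻ˡ (generated (absA a k)) hold)
    as⇔ = absAs-correct τ as _ (++⁻ʳ (generated (absA a k)) hold)

  module FreshValues (σ : ℕ → D) where

    mutual
      FitsT : Term L ℕ → ℕ → (ℕ → D) → Set
      FitsT (var _)    k ρ = ⊤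
      FitsT (app f ts) k ρ = FitsTs ts k ρ × ρ (nextFresh (absTs ts k)) ≡ evalT J σ (app f ts)

      FitsTs : ∀ {n} → Vec (Term L ℕ) n → ℕ → (ℕ → D) → Set
      FitsTs []       k ρ = ⊤
      FitsTs (t ∷ ts) k ρ = FitsT t k ρ × FitsTs ts (nextFresh (absT t k)) ρ

    FitsAs : List (Atom L ℕ) → ℕ → (ℕ → D) → Set
    FitsAs []                 k ρ = ⊤
    FitsAs (atom _ ts ∷ as) k ρ = FitsTs ts k ρ × FitsAs as (nextFresh (absTs ts k)) ρ

    mutual
      fitsT-fillable : ∀ t k → Fillable k (nextFresh (absT t k)) (FitsT t k)
      fitsT-fillable (var _)    k = fillable-⊤
      fitsT-fillable (app f ts) k = fillable-point (fitsTs-fillable ts k) _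

      fitsTs-fillable : ∀ {n} (ts : Vec (Term L ℕ) n) k →
                        Fillable k (nextFresh (absTs ts k)) (FitsTs ts k)
      fitsTs-fillable []       k = fillable-⊤
      fitsTs-fillable (t ∷ ts) k = fillable-× (fitsT-fillable t k) (fitsTs-fillable ts _)

    fitsAs-fillable : ∀ as k → Fillable k (nextFresh (absAs as k)) (FitsAs as k)
    fitsAs-fillable []                 k = fillable-⊤
    fitsAs-fillable (atom _ ts ∷ as) k = fillable-× (fitsTs-fillable ts k) (fitsAs-fillable as _)

    mutual
      fitsT-generated : ∀ t k ρ → FitsT t k ρ → All (Holds [ σ , ρ ]) (generated (absT t k))
      fitsT-generated (var _)    k ρ _               = []
      fitsT-generated (app f ts) k ρ (fits , ρn≡ft) =
        ++⁺ hold (from (pf-holds [ σ , ρ ] f _ _)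
                   (trans (cong (fun J f) (absTs-sound [ σ , ρ ] ts k hold)) (sym ρn≡ft)) ∷ [])
        where hold = fitsTs-generated ts k ρ fits

      fitsTs-generated : ∀ {n} (ts : Vec (Term L ℕ) n) k ρ → FitsTs ts k ρ →
                         All (Holds [ σ , ρ ]) (generated (absTs ts k))
      fitsTs-generated []       k ρ _            = []
      fitsTs-generated (t ∷ ts) k ρ (fit , fits) =
        ++⁺ (fitsT-generated t k ρ fit) (fitsTs-generated ts _ ρ fits)

    fitsAs-generated : ∀ as k ρ → FitsAs as k ρ → All (Holds [ σ , ρ ]) (generated (absAs as k))
    fitsAs-generated []                 k ρ _            = []
    fitsAs-generated (atom _ ts ∷ as) k ρ (fit , fits) =
      ++⁺ (fitsTs-generated ts k ρ fit) (fitsAs-generated as _ ρ fits)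

  generated-satisfiable : ∀ (σ : ℕ → D) as k →
                          Σ (ℕ → D) λ ρ → All (Holds [ σ , ρ ]) (generated (absAs as k))
  generated-satisfiable σ as k =
    -- σ merely serves as some starting assignment of the fresh variables.
    let (ρ , fits , _) = fill (fitsAs-fillable as k) σ
    in ρ , fitsAs-generated as k ρ fits
    where open FreshValues σ

  absClause-sound : ∀ h b τ → ClauseTrue J (τ ∘ inj₁) I (toClause (h ⇐ b)) →
                    ClauseTrue HJ τ (Ia I) (toClause (absClause (h ⇐ b)))
  absClause-sound h b τ clause hold =
    let (body , gen) = ++⁻ (result (absAs b _)) hold
        gen-h = ++⁻ˡ (generated (absA h 0)) gen
        gen-b = ++⁻ʳ (generated (absA h 0)) gen
    in from (absA-correct τ h 0 gen-h) (clause (to (absAs-correct τ b _ gen-b) body))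

  absClause-complete : ∀ h b σ → (∀ τ → ClauseTrue HJ τ (Ia I) (toClause (absClause (h ⇐ b)))) →
                       ClauseTrue J σ I (toClause (h ⇐ b))
  absClause-complete h b σ clause body =
    let (ρ , gen) = generated-satisfiable σ (h ∷ b) 0
        gen-h = ++⁻ˡ (generated (absA h 0)) gen
        gen-b = ++⁻ʳ (generated (absA h 0)) gen
    in to (absA-correct [ σ , ρ ] h 0 gen-h)
          (clause [ σ , ρ ] (++⁺ (from (absAs-correct [ σ , ρ ] b _ gen-b) body) gen))

  absQuery-sound : ∀ Q τ → ClauseTrue J (τ ∘ inj₁) I (denial Q) →
                   ClauseTrue HJ τ (Ia I) (denial (absQuery Q))
  absQuery-sound Q τ refuted hold =
    let (body , gen) = ++⁻ (result (absAs Q 0)) hold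
    in refuted (to (absAs-correct τ Q 0 gen) body)

  absQuery-complete : ∀ Q σ → (∀ τ → ClauseTrue HJ τ (Ia I) (denial (absQuery Q))) →
                      ClauseTrue J σ I (denial Q)
  absQuery-complete Q σ refuted body =
    let (ρ , gen) = generated-satisfiable σ Q 0
    in refuted [ σ , ρ ] (++⁺ (from (absAs-correct [ σ , ρ ] Q 0 gen) body) gen)

  module _ (P : List (DefClause L ℕ)) (Q : List (Atom L ℕ)) where

    Clausesᵃ : ClauseSet La AVar
    Clausesᵃ = (fromList (absProgram P) ∪ PaJ) ∪ singleton (denial (absQuery Q))

    models-abstraction : Models J I (fromList P ∪ singleton (denial Q)) → Models HJ (Ia I) Clausesᵃ
    models-abstraction M _ (inj₁ (inj₁ c∈Pᵃ)) τ with ∈-map⁻ toClause c∈Pᵃ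
    ... | _ , d∈Pᵃ , refl with ∈-map⁻ absClause d∈Pᵃ
    ... | h ⇐ b , d∈P , refl =
      absClause-sound h b τ (M _ (inj₁ (∈-map⁺ toClause d∈P)) (τ ∘ inj₁))
    models-abstraction M _ (inj₁ (inj₂ (f , ds , refl))) τ _ = PaJ-holds τ f ds
    models-abstraction M _ (inj₂ refl) τ =
      absQuery-sound Q τ (M _ (inj₂ refl) (τ ∘ inj₁))

    abstraction-models : Models HJ (Ia I) Clausesᵃ → Models J I (fromList P ∪ singleton (denial Q))
    abstraction-models Mᵃ _ (inj₁ c∈P) σ with ∈-map⁻ toClause c∈P
    ... | h ⇐ b , d∈P , refl =
      absClause-complete h b σ (Mᵃ _ (inj₁ (inj₁ (∈-map⁺ toClause (∈-map⁺ absClause d∈P)))))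
    abstraction-models Mᵃ _ (inj₂ refl) σ = absQuery-complete Q σ (Mᵃ _ (inj₂ refl))

theorem1 : (L : Lang) (P : List (DefClause L ℕ)) (Q : List (Atom L ℕ))
           (J : PreInterp L) (I : Interp L J) →
           Models J I (fromList P ∪ singleton (denial Q))
           ⇔ Models (Abstraction.HJ L J) (Abstraction.Ia L J I)
               ((fromList (Abstraction.absProgram L J P) ∪ Abstraction.PaJ L J)
                 ∪ singleton (denial (Abstraction.absQuery L J Q)))
theorem1 L P Q J I = mk⇔ (models-abstraction P Q) (abstraction-models P Q)
  where open Correctness L J I
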